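{- The relation $\rightarrow_d$ on microCCS processes is strongly normalising and confluent.
   Context: MicroCCS processes: $\eta ::= a \mid \overline{a}$ (names $a$), $P ::= \mathbf{0} \mid \eta.P \mid P|Q$. Structural congruence $\equiv$ is the smallest congruence with $P|Q\equiv Q|P$, $P|(Q|R)\equiv(P|Q)|R$, $P|\mathbf 0\equiv P$. $R^k$ is the $k$-fold parallel composition of $R$. $P\rightarrow_d P'$ holds when there are $P_1,P_2$ with $P\equiv P_1$, $P_2\equiv P'$ and $P_2$ obtained from $P_1$ by replacing a subterm of the form $\eta.(R|(\eta.R)^k)$, $k\geq1$, by $(\eta.R)^{k+1}$. -}

module Defs where

open import Data.Nat using (ℕ; zero; suc)
open import Data.Product using (Σ; ∃; _×_; _,_)
open import Induction.WellFounded using (WellFounded)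
open import Relation.Binary.Construct.Closure.ReflexiveTransitive using (Star)
open import Function using (flip)

data Prefix (N : Set) : Set where
  inp : N → Prefix N
  out : N → Prefix N

data Proc (N : Set) : Set where
  𝟎   : Proc N
  _∙_ : Prefix N → Proc N → Proc N
  _∣_ : Proc N → Proc N → Proc N

infixr 7 _∙_
infixl 6 _∣_

_^_ : ∀ {N} → Proc N → ℕ → Proc N
R ^ zero = 𝟎
R ^ suc zero = R
R ^ suc (suc k) = R ∣ (R ^ suc k)

data _≡s_ {N : Set} : Proc N → Proc N → Set where
  ≡-refl  : ∀ {P} → P ≡s P
  ≡-sym   : ∀ {P Q} → P ≡s Q → Q ≡s P
  ≡-trans : ∀ {P Q R} → P ≡s Q → Q ≡s R → P ≡s R
  ≡-pre   : ∀ {η P Q} → P ≡s Q → (η ∙ P) ≡s (η ∙ Q)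
  ≡-par   : ∀ {P P' Q Q'} → P ≡s P' → Q ≡s Q' → (P ∣ Q) ≡s (P' ∣ Q')
  ≡-comm  : ∀ {P Q} → (P ∣ Q) ≡s (Q ∣ P)
  ≡-assoc : ∀ {P Q R} → (P ∣ (Q ∣ R)) ≡s ((P ∣ Q) ∣ R)
  ≡-unit  : ∀ {P} → (P ∣ 𝟎) ≡s P

data Replace {N : Set} : Proc N → Proc N → Set where
  here  : ∀ {η R} (k : ℕ) →
          Replace (η ∙ (R ∣ ((η ∙ R) ^ suc k))) ((η ∙ R) ^ suc (suc k))
  under : ∀ {η P Q} → Replace P Q → Replace (η ∙ P) (η ∙ Q)
  parL  : ∀ {P P' Q} → Replace P P' → Replace (P ∣ Q) (P' ∣ Q)
  parR  : ∀ {P Q Q'} → Replace Q Q' → Replace (P ∣ Q) (P ∣ Q')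

_→d_ : ∀ {N} → Proc N → Proc N → Set
P →d P' = ∃ λ P₁ → ∃ λ P₂ → P ≡s P₁ × Replace P₁ P₂ × P₂ ≡s P'

_→d*_ : ∀ {N} → Proc N → Proc N → Set
_→d*_ = Star _→d_

-- Strong normalisation: every process is accessible for the converse of →d
-- (no infinite →d-reduction sequence, constructively).
StronglyNormalising : ∀ {N} → Set
StronglyNormalising {N} = WellFounded (flip (_→d_ {N}))

-- Confluence (modulo structural congruence, since →d is defined on ≡-classes):
Confluent : ∀ {N} → Set
Confluent {N} = ∀ {P Q R : Proc N} → P →d* Q → P →d* R →
  ∃ λ S → ∃ λ S' → Q →d* S × R →d* S' × S ≡s S'

-- A process modulo ≡s is a forest: a list of prefix-labelled trees, taken up to
-- permutation at every level. A →d step moves the subterm R one prefix level up,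
-- so the weight of a process (the sum over its prefixes of their nesting depth)
-- strictly decreases, which gives strong normalisation. For confluence, by
-- Newman's lemma modulo ≡s it suffices to join one-step peaks, and on forests
-- there are only two genuine critical pairs. Two folds of the same node agree,
-- because the body R ++ (η·R)^(k+1) determines R and k. A fold against a step
-- inside its body is closed by performing that step in R and in every copy of
-- η·R (or, if the step folds a copy of η·R itself, by folding every copy) and
-- folding afterwards.

module Submission where

open import Data.Empty using (⊥-elim)
open import Data.List using (List; []; _∷_; [_]; _++_; concat; replicate; length)
open import Data.List.Properties using (++-assoc; ++-identityʳ; length-++; length-replicate)
import Data.List.Membership.Setoid as Membership
open import Data.List.Membership.Setoid.Properties using (∈-++⁺ʳ; ∈-++⁻)
open import Data.List.Relation.Binary.Permutation.Homogeneous as Perm using (Permutation)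
import Data.List.Relation.Binary.Permutation.Setoid as PermutationSetoid
import Data.List.Relation.Binary.Permutation.Setoid.Properties as PermutationProperties
open import Data.List.Relation.Binary.Pointwise as Pointwise using (Pointwise; []; _∷_)
open import Data.List.Relation.Unary.Any using (here; there)
open import Data.Nat using (ℕ; zero; suc; _+_; _*_; _≤_; _<_; z≤n; s≤s)
open import Data.Nat.Induction using (<-wellFounded)
open import Data.Nat.Properties
  using (+-comm; +-assoc; +-identityʳ; +-cancelˡ-≡; suc-injective; ≤-reflexive; ≤-trans;
         m≤m+n; m≤n+m; m<m+n; <-asym; +-monoˡ-<; +-monoʳ-<; +-mono-≤-<; module ≤-Reasoning)
open import Data.Product using (_×_; ∃; _,_)
open import Data.Sum using (_⊎_; inj₁; inj₂; map₂)
open import Function using (flip)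
open import Induction.WellFounded using (WellFounded; Acc; acc; module Subrelation)
import Relation.Binary.Construct.On as On
open import Level using (_⊔_)
open import Relation.Binary.Bundles using (Setoid)
open import Relation.Binary.Construct.Closure.ReflexiveTransitive using (Star; ε; _◅_; _◅◅_; gmap)
open import Relation.Binary.Core using (Rel)
open import Relation.Binary.PropositionalEquality
  using (_≡_; refl; sym; trans; cong; cong₂; subst; subst₂; module ≡-Reasoning)
open import Relation.Binary.Structures using (IsEquivalence)

module _ {a} {A : Set a} where

  replicate-+ : ∀ m n (x : A) → replicate (m + n) x ≡ replicate m x ++ replicate n x
  replicate-+ zero    n x = refl
  replicate-+ (suc m) n x = cong (x ∷_) (replicate-+ m n x)

  concat-replicate-[] : ∀ n (x : A) → concat (replicate n [ x ]) ≡ replicate n x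
  concat-replicate-[] zero    x = refl
  concat-replicate-[] (suc n) x = cong (x ∷_) (concat-replicate-[] n x)

  concat-replicate-replicate : ∀ m n (x : A) →
                               concat (replicate m (replicate n x)) ≡ replicate (m * n) x
  concat-replicate-replicate zero    n x = refl
  concat-replicate-replicate (suc m) n x = begin
    replicate n x ++ concat (replicate m (replicate n x))
      ≡⟨ cong (replicate n x ++_) (concat-replicate-replicate m n x) ⟩
    replicate n x ++ replicate (m * n) x
      ≡⟨ replicate-+ n (m * n) x ⟨
    replicate (n + m * n) x
      ∎
    where open ≡-Reasoning

  length-++-replicate : ∀ (xs : List A) n x → length (xs ++ replicate n x) ≡ length xs + n
  length-++-replicate xs n x = trans (length-++ xs) (cong (length xs +_) (length-replicate n))

-- Newman's lemma modulo ≈ needs Simulation, because joins only meet up to ≈.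
module RewritingModulo {a ℓ r} {A : Set a} {_≈_ : Rel A ℓ}
                       (≈-isEquivalence : IsEquivalence _≈_) (_⟶_ : Rel A r) where

  open IsEquivalence ≈-isEquivalence
    renaming (refl to ≈-refl; sym to ≈-sym; trans to ≈-trans)

  private
    _⟶*_ : Rel A (a ⊔ r)
    _⟶*_ = Star _⟶_

    variable
      x x′ y y′ z : A

  Joinable : Rel A (a ⊔ ℓ ⊔ r)
  Joinable x y = ∃ λ x′ → ∃ λ y′ → x ⟶* x′ × y ⟶* y′ × x′ ≈ y′

  Simulation : Set (a ⊔ ℓ ⊔ r)
  Simulation = ∀ {x x′ y} → x ≈ x′ → x ⟶ y → ∃ λ y′ → x′ ⟶ y′ × y ≈ y′

  WeaklyConfluent : Set (a ⊔ ℓ ⊔ r)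
  WeaklyConfluent = ∀ {x y z} → x ⟶ y → x ⟶ z → Joinable y z

  Confluent : Set (a ⊔ ℓ ⊔ r)
  Confluent = ∀ {x y z} → x ⟶* y → x ⟶* z → Joinable y z

  Joinable-sym : Joinable x y → Joinable y x
  Joinable-sym (x′ , y′ , x⟶*x′ , y⟶*y′ , x′≈y′) = y′ , x′ , y⟶*y′ , x⟶*x′ , ≈-sym x′≈y′

  Joinable-map : (f : A → A) → (∀ {x y} → x ⟶ y → f x ⟶ f y) →
                 (∀ {x y} → x ≈ y → f x ≈ f y) → Joinable x y → Joinable (f x) (f y)
  Joinable-map f f-⟶ f-≈ (x′ , y′ , x⟶*x′ , y⟶*y′ , x′≈y′) =
    f x′ , f y′ , gmap f f-⟶ x⟶*x′ , gmap f f-⟶ y⟶*y′ , f-≈ x′≈y′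

  ◅◅-Joinable : x ⟶* x′ → Joinable x′ y → Joinable x y
  ◅◅-Joinable x⟶*x′ (u , v , x′⟶*u , y⟶*v , u≈v) = u , v , x⟶*x′ ◅◅ x′⟶*u , y⟶*v , u≈v

  module _ (simulate : Simulation) where

    simulate* : x ≈ x′ → x ⟶* y → ∃ λ y′ → x′ ⟶* y′ × y ≈ y′
    simulate* x≈x′ ε = _ , ε , x≈x′
    simulate* x≈x′ (s ◅ ss) with simulate x≈x′ s
    ... | _ , s′ , e with simulate* e ss
    ... | y′ , ss′ , e′ = y′ , s′ ◅ ss′ , e′

    Joinable-resp-≈ : x ≈ x′ → y ≈ y′ → Joinable x′ y′ → Joinable x y
    Joinable-resp-≈ x≈x′ y≈y′ (u , v , x′⟶*u , y′⟶*v , u≈v)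
      with simulate* (≈-sym x≈x′) x′⟶*u | simulate* (≈-sym y≈y′) y′⟶*v
    ... | u′ , x⟶*u′ , u≈u′ | v′ , y⟶*v′ , v≈v′ =
      u′ , v′ , x⟶*u′ , y⟶*v′ , ≈-trans (≈-sym u≈u′) (≈-trans u≈v v≈v′)

    sn&wcr⇒cr : WellFounded (flip _⟶_) → WeaklyConfluent → Confluent
    sn&wcr⇒cr wf wcr = join (wf _)
      where
      join : Acc (flip _⟶_) x → x ⟶* y → x ⟶* z → Joinable y z
      join _ ε x⟶*z = _ , _ , x⟶*z , ε , ≈-refl
      join _ x⟶*y@(_ ◅ _) ε = _ , _ , ε , x⟶*y , ≈-refl
      join (acc rs) (s₁ ◅ y₁⟶*y) (s₂ ◅ y₂⟶*z) with wcr s₁ s₂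
      ... | u₁ , u₂ , y₁⟶*u₁ , y₂⟶*u₂ , u₁≈u₂ with join (rs s₁) y₁⟶*y y₁⟶*u₁
      ... | v , v₁ , y⟶*v , u₁⟶*v₁ , v≈v₁ with simulate* u₁≈u₂ u₁⟶*v₁
      ... | v₂ , u₂⟶*v₂ , v₁≈v₂ =
        ◅◅-Joinable y⟶*v (Joinable-resp-≈ (≈-trans v≈v₁ v₁≈v₂) ≈-refl
                            (join (rs s₂) (y₂⟶*u₂ ◅◅ u₂⟶*v₂) y₂⟶*z))

open import Defs

module _ {N : Set} where

  private
    variable
      η : Prefix N
      P Q : Proc N

  ≡s-isEquivalence : IsEquivalence (_≡s_ {N})
  ≡s-isEquivalence = record { refl = ≡-refl ; sym = ≡-sym ; trans = ≡-trans }

  module ≡s-Rewriting = RewritingModulo ≡s-isEquivalence (_→d_ {N})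

  ∣-exchange : ∀ {P Q R : Proc N} → (P ∣ (Q ∣ R)) ≡s (Q ∣ (P ∣ R))
  ∣-exchange = ≡-trans ≡-assoc (≡-trans (≡-par ≡-comm ≡-refl) (≡-sym ≡-assoc))

  →d-resp-≡s : ∀ {P P′ Q′ Q : Proc N} → P ≡s P′ → P′ →d Q′ → Q′ ≡s Q → P →d Q
  →d-resp-≡s P≡P′ (P₁ , P₂ , P′≡P₁ , r , P₂≡Q′) Q′≡Q =
    P₁ , P₂ , ≡-trans P≡P′ P′≡P₁ , r , ≡-trans P₂≡Q′ Q′≡Q

  →d-simulation : ≡s-Rewriting.Simulation
  →d-simulation P≡P′ P→Q = _ , →d-resp-≡s (≡-sym P≡P′) P→Q ≡-refl , ≡-refl

  →d-prefix : P →d Q → (η ∙ P) →d (η ∙ Q)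
  →d-prefix (_ , _ , P≡P₁ , r , P₂≡Q) = _ , _ , ≡-pre P≡P₁ , under r , ≡-pre P₂≡Q

  →d-parˡ : ∀ {R} → P →d Q → (P ∣ R) →d (Q ∣ R)
  →d-parˡ (_ , _ , P≡P₁ , r , P₂≡Q) = _ , _ , ≡-par P≡P₁ ≡-refl , parL r , ≡-par P₂≡Q ≡-refl

  →d-parʳ : ∀ {R} → P →d Q → (R ∣ P) →d (R ∣ Q)
  →d-parʳ (_ , _ , P≡P₁ , r , P₂≡Q) = _ , _ , ≡-par ≡-refl P≡P₁ , parR r , ≡-par ≡-refl P₂≡Q

  size : Proc N → ℕ
  size 𝟎       = 0
  size (η ∙ P) = suc (size P)
  size (P ∣ Q) = size P + size Q

  weight : Proc N → ℕ
  weight 𝟎       = 0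
  weight (η ∙ P) = size (η ∙ P) + weight P
  weight (P ∣ Q) = weight P + weight Q

  size-resp-≡s : P ≡s Q → size P ≡ size Q
  size-resp-≡s ≡-refl                 = refl
  size-resp-≡s (≡-sym e)              = sym (size-resp-≡s e)
  size-resp-≡s (≡-trans e f)          = trans (size-resp-≡s e) (size-resp-≡s f)
  size-resp-≡s (≡-pre e)              = cong suc (size-resp-≡s e)
  size-resp-≡s (≡-par e f)            = cong₂ _+_ (size-resp-≡s e) (size-resp-≡s f)
  size-resp-≡s (≡-comm {P} {Q})       = +-comm (size P) (size Q)
  size-resp-≡s (≡-assoc {P} {Q} {R})  = sym (+-assoc (size P) (size Q) (size R))
  size-resp-≡s ≡-unit                 = +-identityʳ _

  weight-resp-≡s : P ≡s Q → weight P ≡ weight Q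
  weight-resp-≡s ≡-refl                = refl
  weight-resp-≡s (≡-sym e)             = sym (weight-resp-≡s e)
  weight-resp-≡s (≡-trans e f)         = trans (weight-resp-≡s e) (weight-resp-≡s f)
  weight-resp-≡s (≡-pre e)             = cong₂ (λ s w → suc s + w) (size-resp-≡s e) (weight-resp-≡s e)
  weight-resp-≡s (≡-par e f)           = cong₂ _+_ (weight-resp-≡s e) (weight-resp-≡s f)
  weight-resp-≡s (≡-comm {P} {Q})      = +-comm (weight P) (weight Q)
  weight-resp-≡s (≡-assoc {P} {Q} {R}) = sym (+-assoc (weight P) (weight Q) (weight R))
  weight-resp-≡s ≡-unit                = +-identityʳ _

  size-prefix^-positive : ∀ {R : Proc N} k → 0 < size ((η ∙ R) ^ suc k)
  size-prefix^-positive zero    = s≤s z≤n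
  size-prefix^-positive (suc k) = s≤s z≤n

  Replace-preserves-size : Replace P Q → size Q ≡ size P
  Replace-preserves-size (here k)         = refl
  Replace-preserves-size (under r)        = cong suc (Replace-preserves-size r)
  Replace-preserves-size (parL {Q = R} r) = cong (_+ size R) (Replace-preserves-size r)
  Replace-preserves-size (parR {P = R} r) = cong (size R +_) (Replace-preserves-size r)

  Replace-decreases-weight : Replace P Q → weight Q < weight P
  Replace-decreases-weight (here {η} {R} k) = s≤s (begin-strict
    size R + weight R + weight X
      ≡⟨ +-assoc (size R) (weight R) (weight X) ⟩
    size R + (weight R + weight X)
      <⟨ +-monoˡ-< _ (m<m+n (size R) (size-prefix^-positive k)) ⟩
    size R + size X + (weight R + weight X)
      ∎)
    where
    X = (η ∙ R) ^ suc k
    open ≤-Reasoning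
  Replace-decreases-weight (under r) =
    s≤s (+-mono-≤-< (≤-reflexive (Replace-preserves-size r)) (Replace-decreases-weight r))
  Replace-decreases-weight (parL r) = +-monoˡ-< _ (Replace-decreases-weight r)
  Replace-decreases-weight (parR r) = +-monoʳ-< _ (Replace-decreases-weight r)

  →d-decreases-weight : P →d Q → weight Q < weight P
  →d-decreases-weight (_ , _ , P≡P₁ , r , P₂≡Q) =
    subst₂ _<_ (weight-resp-≡s P₂≡Q) (sym (weight-resp-≡s P≡P₁)) (Replace-decreases-weight r)

  →d-wellFounded : StronglyNormalising {N}
  →d-wellFounded =
    Subrelation.wellFounded →d-decreases-weight (On.wellFounded weight <-wellFounded)

  infixr 6 _·_
  infix  4 _≃_ _↭_ _≋_

  data Tree : Set where
    _·_ : Prefix N → List Tree → Tree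

  Forest : Set
  Forest = List Tree

  data _≃_ : Tree → Tree → Set where
    node : ∀ {η F G} → Permutation _≃_ F G → η · F ≃ η · G

  _↭_ : Rel Forest _
  _↭_ = Permutation _≃_

  _≋_ : Rel Forest _
  _≋_ = Pointwise _≃_

  private
    variable
      t u : Tree
      F F′ G H L L′ R R′ : Forest
      k k′ n : ℕ

  mutual
    ≃-refl : t ≃ t
    ≃-refl {_ · F} = node (Perm.refl ≋-refl)

    ≋-refl : F ≋ F
    ≋-refl {[]}    = []
    ≋-refl {_ ∷ F} = ≃-refl ∷ ≋-refl

  mutual
    ≃-sym : t ≃ u → u ≃ t
    ≃-sym (node p) = node (↭-sym p)

    ↭-sym : F ↭ G → G ↭ F
    ↭-sym (Perm.refl ps)       = Perm.refl (≋-sym ps)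
    ↭-sym (Perm.prep e p)      = Perm.prep (≃-sym e) (↭-sym p)
    ↭-sym (Perm.swap e₁ e₂ p)  = Perm.swap (≃-sym e₂) (≃-sym e₁) (↭-sym p)
    ↭-sym (Perm.trans p q)     = Perm.trans (↭-sym q) (↭-sym p)

    ≋-sym : F ≋ G → G ≋ F
    ≋-sym []       = []
    ≋-sym (e ∷ ps) = ≃-sym e ∷ ≋-sym ps

  ≃-trans : ∀ {t u v} → t ≃ u → u ≃ v → t ≃ v
  ≃-trans (node p) (node q) = node (Perm.trans p q)

  ≃-setoid : Setoid _ _
  ≃-setoid = record
    { Carrier = Tree
    ; _≈_ = _≃_
    ; isEquivalence = record { refl = ≃-refl ; sym = ≃-sym ; trans = ≃-trans }
    }

  open PermutationSetoid ≃-setoid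
    using (↭-refl; ↭-reflexive; ↭-trans; ↭-isEquivalence; module PermutationReasoning)
  open PermutationProperties ≃-setoid
    using (++⁺; ++⁺ˡ; ++⁺ʳ; ++-comm; ↭-shift; ∈-resp-↭)
    renaming (xs↭ys⇒|xs|≡|ys| to ↭-length)
  open Membership ≃-setoid using (_∈_)

  mutual
    fromTree : Tree → Proc N
    fromTree (η · F) = η ∙ fromForest F

    fromForest : Forest → Proc N
    fromForest []      = 𝟎
    fromForest (t ∷ F) = fromTree t ∣ fromForest F

  mutual
    fromTree-resp-≃ : t ≃ u → fromTree t ≡s fromTree u
    fromTree-resp-≃ (node p) = ≡-pre (fromForest-resp-↭ p)

    fromForest-resp-↭ : F ↭ G → fromForest F ≡s fromForest G
    fromForest-resp-↭ (Perm.refl ps)      = fromForest-resp-≋ ps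
    fromForest-resp-↭ (Perm.prep e p)     = ≡-par (fromTree-resp-≃ e) (fromForest-resp-↭ p)
    fromForest-resp-↭ (Perm.swap e₁ e₂ p) = ≡-trans ∣-exchange
      (≡-par (fromTree-resp-≃ e₂) (≡-par (fromTree-resp-≃ e₁) (fromForest-resp-↭ p)))
    fromForest-resp-↭ (Perm.trans p q)    = ≡-trans (fromForest-resp-↭ p) (fromForest-resp-↭ q)

    fromForest-resp-≋ : F ≋ G → fromForest F ≡s fromForest G
    fromForest-resp-≋ []       = ≡-refl
    fromForest-resp-≋ (e ∷ ps) = ≡-par (fromTree-resp-≃ e) (fromForest-resp-≋ ps)

  fromForest-++ : ∀ F G → fromForest (F ++ G) ≡s (fromForest F ∣ fromForest G)
  fromForest-++ []      G = ≡-sym (≡-trans ≡-comm ≡-unit)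
  fromForest-++ (t ∷ F) G = ≡-trans (≡-par ≡-refl (fromForest-++ F G)) ≡-assoc

  fromForest-replicate : ∀ n t → fromForest (replicate (suc n) t) ≡s (fromTree t ^ suc n)
  fromForest-replicate zero    t = ≡-unit
  fromForest-replicate (suc n) t = ≡-par ≡-refl (fromForest-replicate n t)

  infix 4 _⟶ᵗ_ _⟶_ _⟶*_

  mutual
    data _⟶ᵗ_ : Tree → Forest → Set where
      fold   : ∀ {η F R k} → F ↭ R ++ replicate (suc k) (η · R) →
               η · F ⟶ᵗ replicate (suc (suc k)) (η · R)
      inside : ∀ {η F G} → F ⟶ G → η · F ⟶ᵗ [ η · G ]

    data _⟶_ : Forest → Forest → Set where
      head : ∀ {t L F} → t ⟶ᵗ L → t ∷ F ⟶ L ++ F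
      tail : ∀ {t F G} → F ⟶ G → t ∷ F ⟶ t ∷ G

  _⟶*_ : Rel Forest _
  _⟶*_ = Star _⟶_

  ⟶-singleton : t ⟶ᵗ L → [ t ] ⟶ L
  ⟶-singleton {L = L} ts = subst ([ _ ] ⟶_) (++-identityʳ L) (head ts)

  ⟶-++ˡ : ∀ E → F ⟶ G → E ++ F ⟶ E ++ G
  ⟶-++ˡ []      s = s
  ⟶-++ˡ (t ∷ E) s = tail (⟶-++ˡ E s)

  ⟶-++ʳ : ∀ E → F ⟶ G → F ++ E ⟶ G ++ E
  ⟶-++ʳ E (head {L = L} {F} ts) = subst (_ ⟶_) (sym (++-assoc L F E)) (head ts)
  ⟶-++ʳ E (tail s)              = tail (⟶-++ʳ E s)

  ⟶*-++ˡ : ∀ E → F ⟶* G → E ++ F ⟶* E ++ G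
  ⟶*-++ˡ E = gmap (E ++_) (⟶-++ˡ E)

  ⟶*-++ʳ : ∀ E → F ⟶* G → F ++ E ⟶* G ++ E
  ⟶*-++ʳ E = gmap (_++ E) (⟶-++ʳ E)

  ⟶*-inside : F ⟶* G → [ η · F ] ⟶* [ η · G ]
  ⟶*-inside = gmap (λ F → [ _ · F ]) (λ s → head (inside s))

  ⟶-++⁻ : ∀ E → E ++ F ⟶ G →
          (∃ λ E′ → E ⟶ E′ × G ≡ E′ ++ F) ⊎ (∃ λ F′ → F ⟶ F′ × G ≡ E ++ F′)
  ⟶-++⁻ []      s = inj₂ (_ , s , refl)
  ⟶-++⁻ {F = F} (t ∷ E) (head {L = L} ts) = inj₁ (L ++ E , head ts , sym (++-assoc L E F))
  ⟶-++⁻ (t ∷ E) (tail s) with ⟶-++⁻ E s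
  ... | inj₁ (E′ , s′ , refl) = inj₁ (t ∷ E′ , tail s′ , refl)
  ... | inj₂ (F′ , s′ , refl) = inj₂ (F′ , s′ , refl)

  mutual
    ≃-simulates-⟶ᵗ : t ≃ u → t ⟶ᵗ L → ∃ λ L′ → u ⟶ᵗ L′ × L ↭ L′
    ≃-simulates-⟶ᵗ (node p) (fold q)   = _ , fold (↭-trans (↭-sym p) q) , ↭-refl
    ≃-simulates-⟶ᵗ (node p) (inside s) with ↭-simulates p s
    ... | _ , s′ , q = _ , inside s′ , Perm.prep (node q) ↭-refl

    ↭-simulates : F ↭ F′ → F ⟶ G → ∃ λ G′ → F′ ⟶ G′ × G ↭ G′
    ↭-simulates (Perm.refl ps) s = ≋-simulates ps s
    ↭-simulates (Perm.prep e p) (head ts) with ≃-simulates-⟶ᵗ e ts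
    ... | _ , ts′ , q = _ , head ts′ , ++⁺ q p
    ↭-simulates (Perm.prep e p) (tail s) with ↭-simulates p s
    ... | _ , s′ , q = _ , tail s′ , Perm.prep e q
    ↭-simulates (Perm.swap e₁ e₂ p) (head ts) with ≃-simulates-⟶ᵗ e₁ ts
    ... | L′ , ts′ , q = _ , tail (head ts′) , ↭-trans (++⁺ q (Perm.prep e₂ p)) (↭-shift L′ _)
    ↭-simulates (Perm.swap e₁ e₂ p) (tail (head ts)) with ≃-simulates-⟶ᵗ e₂ ts
    ... | L′ , ts′ , q = _ , head ts′ , ↭-trans (Perm.prep e₁ (++⁺ q p)) (↭-sym (↭-shift L′ _))
    ↭-simulates (Perm.swap e₁ e₂ p) (tail (tail s)) with ↭-simulates p s
    ... | _ , s′ , q = _ , tail (tail s′) , Perm.swap e₁ e₂ q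
    ↭-simulates (Perm.trans p p′) s with ↭-simulates p s
    ... | _ , s₁ , q with ↭-simulates p′ s₁
    ... | G′ , s₂ , q′ = G′ , s₂ , ↭-trans q q′

    ≋-simulates : F ≋ F′ → F ⟶ G → ∃ λ G′ → F′ ⟶ G′ × G ↭ G′
    ≋-simulates (e ∷ ps) (head ts) with ≃-simulates-⟶ᵗ e ts
    ... | _ , ts′ , q = _ , head ts′ , ++⁺ q (Perm.refl ps)
    ≋-simulates (e ∷ ps) (tail s) with ≋-simulates ps s
    ... | _ , s′ , q = _ , tail s′ , Perm.prep e q

  open RewritingModulo ↭-isEquivalence _⟶_
    using (Joinable; WeaklyConfluent; Joinable-sym; Joinable-map; Joinable-resp-≈)

  replicate-⟶* : t ⟶ᵗ L → ∀ n → replicate n t ⟶* concat (replicate n L)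
  replicate-⟶* ts zero = ε
  replicate-⟶* {L = L} ts (suc n) = head ts ◅ ⟶*-++ˡ L (replicate-⟶* ts n)

  replicate-inside : F ⟶ G → ∀ n → replicate n (η · F) ⟶* replicate n (η · G)
  replicate-inside s n = subst (_ ⟶*_) (concat-replicate-[] n _) (replicate-⟶* (inside s) n)

  replicate-fold : ∀ {j} → R ↭ R′ ++ replicate (suc j) (η · R′) →
                   ∀ n → replicate n (η · R) ⟶* replicate (n * suc (suc j)) (η · R′)
  replicate-fold {j = j} R↭ n =
    subst (_ ⟶*_) (concat-replicate-replicate n (suc (suc j)) _) (replicate-⟶* (fold R↭) n)

  replicate-⟶-complete : replicate (suc k) t ⟶ G →
                         ∃ λ L → t ⟶ᵗ L × G ⟶* concat (replicate (suc k) L)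
  replicate-⟶-complete {k = k} (head {L = L} ts) = L , ts , ⟶*-++ˡ L (replicate-⟶* ts k)
  replicate-⟶-complete {k = zero} (tail ())
  replicate-⟶-complete {k = suc k} (tail s) with replicate-⟶-complete s
  ... | L , ts , G⟶* = L , ts , head ts ◅ ⟶*-++ˡ L G⟶*

  ↭-++-replicate : ∀ {m} → R ↭ R′ ++ replicate m t → ∀ n →
                   R ++ replicate n t ↭ R′ ++ replicate (m + n) t
  ↭-++-replicate {R = R} {R′} {t} {m} R↭ n = begin
    R ++ replicate n t                        ↭⟨ ++⁺ʳ _ R↭ ⟩
    (R′ ++ replicate m t) ++ replicate n t    ≡⟨ ++-assoc R′ _ _ ⟩
    R′ ++ replicate m t ++ replicate n t      ≡⟨ cong (R′ ++_) (replicate-+ m n t) ⟨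
    R′ ++ replicate (m + n) t                 ∎
    where open PermutationReasoning

  ⟶*-fold : G ⟶* H → H ↭ R ++ replicate (suc k) (η · R) →
            [ η · G ] ⟶* replicate (suc (suc k)) (η · R)
  ⟶*-fold G⟶*H H↭ = ⟶*-inside G⟶*H ◅◅ ⟶-singleton (fold H↭) ◅ ε

  replicate-inside-joinable : R ⟶ R′ → G ⟶* R′ ++ replicate (suc k) (η · R′) →
                         Joinable (replicate (suc (suc k)) (η · R)) [ η · G ]
  replicate-inside-joinable {k = k} R⟶R′ G⟶* =
    _ , _ , replicate-inside R⟶R′ (suc (suc k)) , ⟶*-fold G⟶* ↭-refl , ↭-refl

  replicate-fold-joinable : ∀ {j} → R ↭ R′ ++ replicate (suc j) (η · R′) →
                       G ⟶* R ++ replicate (suc k * suc (suc j)) (η · R′) →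
                       Joinable (replicate (suc (suc k)) (η · R)) [ η · G ]
  replicate-fold-joinable {R′ = R′} {k = k} {j = j} R↭ G⟶* =
    _ , _ , replicate-fold R↭ (suc (suc k)) ,
    ⟶*-fold G⟶* (↭-++-replicate {R′ = R′} {m = suc j} R↭ (suc k * suc (suc j))) , ↭-refl

  fold-body-joinable : R ++ replicate (suc k) (η · R) ⟶ G →
                       Joinable (replicate (suc (suc k)) (η · R)) [ η · G ]
  fold-body-joinable {R = R} {k = k} s with ⟶-++⁻ R s
  ... | inj₁ (R′ , R⟶R′ , refl) =
    replicate-inside-joinable R⟶R′ (⟶*-++ˡ R′ (replicate-inside R⟶R′ (suc k)))
  ... | inj₂ (C , s′ , refl) with replicate-⟶-complete s′
  ...   | _ , inside R⟶R′ , C⟶* = replicate-inside-joinable R⟶R′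
          (⟶*-++ˡ R (subst (C ⟶*_) (concat-replicate-[] (suc k) _) C⟶*) ◅◅ ⟶*-++ʳ _ (R⟶R′ ◅ ε))
  ...   | _ , fold {k = j} R↭ , C⟶* = replicate-fold-joinable R↭
          (⟶*-++ˡ R (subst (C ⟶*_) (concat-replicate-replicate (suc k) (suc (suc j)) _) C⟶*))

  fold-inside-joinable : F ↭ R ++ replicate (suc k) (η · R) → F ⟶ G →
                         Joinable (replicate (suc (suc k)) (η · R)) [ η · G ]
  fold-inside-joinable F↭ s with ↭-simulates F↭ s
  ... | _ , s′ , G↭G′ =
    Joinable-resp-≈ ↭-simulates ↭-refl (Perm.prep (node G↭G′) ↭-refl) (fold-body-joinable s′)

  ∈-replicate⁻ : t ∈ replicate n u → t ≃ u
  ∈-replicate⁻ {n = suc n} (here t≃u) = t≃u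
  ∈-replicate⁻ {n = suc n} (there t∈) = ∈-replicate⁻ t∈

  ∈⇒size≤ : t ∈ F → size (fromTree t) ≤ size (fromForest F)
  ∈⇒size≤ (here t≃u)  = ≤-trans (≤-reflexive (size-resp-≡s (fromTree-resp-≃ t≃u))) (m≤m+n _ _)
  ∈⇒size≤ (there t∈F) = ≤-trans (∈⇒size≤ t∈F) (m≤n+m _ _)

  fold-tree-∈ : R ++ replicate (suc k) (η · R) ↭ R′ ++ replicate (suc k′) (η · R′) →
                η · R ∈ R′ ⊎ η · R ≃ η · R′
  fold-tree-∈ {R = R} {R′ = R′} p =
    map₂ ∈-replicate⁻ (∈-++⁻ ≃-setoid R′ (∈-resp-↭ p (∈-++⁺ʳ ≃-setoid R (here ≃-refl))))

  -- If η · R occurred in R′ and η · R′ in R, then size R < size R′ < size R.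
  fold-body-unique : R ++ replicate (suc k) (η · R) ↭ R′ ++ replicate (suc k′) (η · R′) →
                     R ↭ R′ × k ≡ k′
  fold-body-unique {R = R} {k = k} {η = η} {R′ = R′} {k′ = k′} p = R↭R′ , k≡k′
    where
    R↭R′ : R ↭ R′
    R↭R′ with fold-tree-∈ p | fold-tree-∈ (↭-sym p)
    ... | inj₂ (node q) | _             = q
    ... | inj₁ _        | inj₂ (node q) = ↭-sym q
    ... | inj₁ ηR∈R′    | inj₁ ηR′∈R    = ⊥-elim (<-asym (∈⇒size≤ ηR∈R′) (∈⇒size≤ ηR′∈R))

    k≡k′ : k ≡ k′
    k≡k′ = suc-injective (+-cancelˡ-≡ (length R) _ _ (begin
      length R + suc k                            ≡⟨ length-++-replicate R (suc k) _ ⟨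
      length (R ++ replicate (suc k) (η · R))     ≡⟨ ↭-length p ⟩
      length (R′ ++ replicate (suc k′) (η · R′))  ≡⟨ length-++-replicate R′ (suc k′) _ ⟩
      length R′ + suc k′                          ≡⟨ cong (_+ suc k′) (↭-length R↭R′) ⟨
      length R + suc k′                           ∎))
      where open ≡-Reasoning

  Joinable-inside : Joinable F G → Joinable [ η · F ] [ η · G ]
  Joinable-inside = Joinable-map _ (λ s → head (inside s)) (λ e → Perm.prep (node e) ↭-refl)

  mutual
    ⟶ᵗ-weaklyConfluent : t ⟶ᵗ L → t ⟶ᵗ L′ → Joinable L L′
    ⟶ᵗ-weaklyConfluent (fold p) (fold p′) with fold-body-unique (↭-trans (↭-sym p) p′)
    ... | R↭R′ , refl = _ , _ , ε , ε , Perm.refl (Pointwise.replicate⁺ (node R↭R′) _)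
    ⟶ᵗ-weaklyConfluent (fold p)   (inside s)  = fold-inside-joinable p s
    ⟶ᵗ-weaklyConfluent (inside s) (fold p)    = Joinable-sym (fold-inside-joinable p s)
    ⟶ᵗ-weaklyConfluent (inside s) (inside s′) = Joinable-inside (⟶-weaklyConfluent s s′)

    ⟶-weaklyConfluent : WeaklyConfluent
    ⟶-weaklyConfluent (head {F = F} ts) (head ts′) =
      Joinable-map (_++ F) (⟶-++ʳ F) (++⁺ʳ F) (⟶ᵗ-weaklyConfluent ts ts′)
    ⟶-weaklyConfluent (head {L = L} ts) (tail s) = _ , _ , ⟶-++ˡ L s ◅ ε , head ts ◅ ε , ↭-refl
    ⟶-weaklyConfluent (tail s) (head {L = L} ts) = _ , _ , head ts ◅ ε , ⟶-++ˡ L s ◅ ε , ↭-refl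
    ⟶-weaklyConfluent (tail {t} s) (tail s′) =
      Joinable-map (t ∷_) tail (Perm.prep ≃-refl) (⟶-weaklyConfluent s s′)

  toForest : Proc N → Forest
  toForest 𝟎       = []
  toForest (η ∙ P) = [ η · toForest P ]
  toForest (P ∣ Q) = toForest P ++ toForest Q

  toForest-resp-≡s : P ≡s Q → toForest P ↭ toForest Q
  toForest-resp-≡s ≡-refl          = ↭-refl
  toForest-resp-≡s (≡-sym e)       = ↭-sym (toForest-resp-≡s e)
  toForest-resp-≡s (≡-trans e f)   = ↭-trans (toForest-resp-≡s e) (toForest-resp-≡s f)
  toForest-resp-≡s (≡-pre e)       = Perm.prep (node (toForest-resp-≡s e)) ↭-refl
  toForest-resp-≡s (≡-par e f)     = ++⁺ (toForest-resp-≡s e) (toForest-resp-≡s f)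
  toForest-resp-≡s (≡-comm {P} {Q}) = ++-comm (toForest P) (toForest Q)
  toForest-resp-≡s (≡-assoc {P} {Q} {R}) =
    ↭-reflexive (sym (++-assoc (toForest P) (toForest Q) (toForest R)))
  toForest-resp-≡s ≡-unit          = ↭-reflexive (++-identityʳ _)

  fromForest-toForest : ∀ P → fromForest (toForest P) ≡s P
  fromForest-toForest 𝟎       = ≡-refl
  fromForest-toForest (η ∙ P) = ≡-trans ≡-unit (≡-pre (fromForest-toForest P))
  fromForest-toForest (P ∣ Q) = ≡-trans (fromForest-++ (toForest P) (toForest Q))
                                        (≡-par (fromForest-toForest P) (fromForest-toForest Q))

  ≡s-fromForest : G ↭ toForest P → P ≡s fromForest G
  ≡s-fromForest {P = P} G↭ = ≡-trans (≡-sym (fromForest-toForest P)) (fromForest-resp-↭ (↭-sym G↭))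

  toForest-prefix^ : ∀ n → toForest ((η ∙ P) ^ n) ≡ replicate n (η · toForest P)
  toForest-prefix^ zero          = refl
  toForest-prefix^ (suc zero)    = refl
  toForest-prefix^ (suc (suc n)) = cong (_ ∷_) (toForest-prefix^ (suc n))

  Replace⇒⟶ : Replace P Q → ∃ λ G → toForest P ⟶ G × G ↭ toForest Q
  Replace⇒⟶ (here {η} {R} k) =
    _ , ⟶-singleton (fold (↭-reflexive (cong (toForest R ++_) (toForest-prefix^ (suc k))))) ,
    ↭-reflexive (sym (toForest-prefix^ (suc (suc k))))
  Replace⇒⟶ (under r) with Replace⇒⟶ r
  ... | _ , s , G↭ = _ , head (inside s) , Perm.prep (node G↭) ↭-refl
  Replace⇒⟶ (parL {Q = R} r) with Replace⇒⟶ r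
  ... | _ , s , G↭ = _ , ⟶-++ʳ (toForest R) s , ++⁺ʳ _ G↭
  Replace⇒⟶ (parR {P = R} r) with Replace⇒⟶ r
  ... | _ , s , G↭ = _ , ⟶-++ˡ (toForest R) s , ++⁺ˡ _ G↭

  →d⇒⟶ : P →d Q → ∃ λ G → toForest P ⟶ G × G ↭ toForest Q
  →d⇒⟶ (_ , _ , P≡P₁ , r , P₂≡Q) with Replace⇒⟶ r
  ... | _ , s , G↭P₂ with ↭-simulates (↭-sym (toForest-resp-≡s P≡P₁)) s
  ... | G′ , s′ , G↭G′ = G′ , s′ , ↭-trans (↭-sym G↭G′) (↭-trans G↭P₂ (toForest-resp-≡s P₂≡Q))

  mutual
    ⟶ᵗ⇒→d : t ⟶ᵗ L → fromTree t →d fromForest L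
    ⟶ᵗ⇒→d (fold {η} {R = R} {k} F↭) =
      _ , _ ,
      ≡-pre (≡-trans (fromForest-resp-↭ F↭)
                     (≡-trans (fromForest-++ R _) (≡-par ≡-refl (fromForest-replicate k (η · R))))) ,
      here k , ≡-sym (fromForest-replicate (suc k) (η · R))
    ⟶ᵗ⇒→d (inside s) = →d-resp-≡s ≡-refl (→d-prefix (⟶⇒→d s)) (≡-sym ≡-unit)

    ⟶⇒→d : F ⟶ G → fromForest F →d fromForest G
    ⟶⇒→d (head {L = L} {F} ts) =
      →d-resp-≡s ≡-refl (→d-parˡ (⟶ᵗ⇒→d ts)) (≡-sym (fromForest-++ L F))
    ⟶⇒→d (tail s) = →d-parʳ (⟶⇒→d s)

  fromForest-Joinable : Joinable F G → ≡s-Rewriting.Joinable (fromForest F) (fromForest G)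
  fromForest-Joinable (_ , _ , F⟶* , G⟶* , F′↭G′) =
    _ , _ , gmap fromForest ⟶⇒→d F⟶* , gmap fromForest ⟶⇒→d G⟶* , fromForest-resp-↭ F′↭G′

  →d-weaklyConfluent : ≡s-Rewriting.WeaklyConfluent
  →d-weaklyConfluent P→Q₁ P→Q₂ with →d⇒⟶ P→Q₁ | →d⇒⟶ P→Q₂
  ... | _ , s₁ , G₁↭ | _ , s₂ , G₂↭ =
    ≡s-Rewriting.Joinable-resp-≈ →d-simulation (≡s-fromForest G₁↭) (≡s-fromForest G₂↭)
      (fromForest-Joinable (⟶-weaklyConfluent s₁ s₂))

lemma1p6 : (N : Set) → StronglyNormalising {N} × Confluent {N}
lemma1p6 N =
  →d-wellFounded , ≡s-Rewriting.sn&wcr⇒cr →d-simulation →d-wellFounded →d-weaklyConfluent
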